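{- Let $G$ be a finite connected graph and $d\ge 1$ an integer. Then $G$ admits a $d$-stable trace if and only if $\delta(G)>d$, where $\delta(G)$ is the minimum degree of $G$.
   Context: A double trace in $G$ is a closed walk $W=v_0e_1v_1\ldots e_\ell v_\ell$ ($v_\ell=v_0$, indices modulo $\ell$) traversing every edge of $G$ exactly twice. For a vertex $v$ and a set $N\subseteq N(v)$ of neighbours of $v$, $W$ has an $N$-repetition at $v$ if for every $i$ with $v_i=v$ we have $v_{i+1}\in N$ if and only if $v_{i-1}\in N$; its order is $|N|$. A $d$-stable trace is a double trace that has no $N$-repetition with $1\le |N|\le d$ at any vertex (in particular, for $d=1$ no "retracing" $v_{i-1}=v_{i+1}$ pattern of a single neighbour, and an $N(v)$-repetition at a vertex $v$ of degree $\le d$ is forbidden). -}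

module Defs where

open import Data.Nat using (ℕ; zero; suc; _+_; _≤_; _<_; NonZero)
open import Data.Nat.DivMod using (_%_; m%n<n)
open import Data.Fin using (Fin; toℕ; fromℕ<) renaming (zero to fzero)
open import Data.Fin.Subset using (Subset; _∈_; _⊆_; ∣_∣)
open import Data.Bool using (Bool; true; false)
open import Data.Vec using (tabulate)
open import Data.Product using (Σ; ∃; ∃-syntax; _×_; _,_)
open import Data.Sum using (_⊎_)
open import Relation.Nullary using (¬_)
open import Relation.Binary.PropositionalEquality using (_≡_; _≢_)

record Graph : Set where
  field
    n     : ℕ
    adj   : Fin n → Fin n → Bool
    sym   : ∀ x y → adj x y ≡ adj y x
    irrefl : ∀ x → adj x x ≡ false

module _ (G : Graph) where
  open Graph G

  Adj : Fin n → Fin n → Set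
  Adj x y = adj x y ≡ true

  Nbhd : Fin n → Subset n
  Nbhd v = tabulate (adj v)

  degree : Fin n → ℕ
  degree v = ∣ Nbhd v ∣

  MinDegreeGreaterThan : ℕ → Set
  MinDegreeGreaterThan d = ∀ v → d < degree v

  record WalkBetween (x y : Fin n) : Set where
    field
      len   : ℕ
      vtx   : ℕ → Fin n
      start : vtx 0 ≡ x
      end   : vtx len ≡ y
      steps : ∀ i → i < len → Adj (vtx i) (vtx (suc i))

  -- Connected (and nonempty).
  Connected : Set
  Connected = Fin n × (∀ x y → WalkBetween x y)

next : ∀ {m} → Fin (suc m) → Fin (suc m)
next {m} i = fromℕ< (m%n<n (suc (toℕ i)) (suc m))

prev : ∀ {m} → Fin (suc m) → Fin (suc m)
prev {m} i = fromℕ< (m%n<n (toℕ i + m) (suc m))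

module _ (G : Graph) where
  open Graph G

  -- A closed walk v_0 e_1 v_1 … e_ℓ v_ℓ (v_ℓ = v_0) of length ℓ = suc m ≥ 1,
  -- recorded by its vertices v_i (i ∈ Fin ℓ, indices modulo ℓ).  Since G is
  -- simple, the edge e_{i+1} is determined by its ends v_i, v_{i+1}.
  record ClosedWalk : Set where
    field
      m      : ℕ
      vtx    : Fin (suc m) → Fin n
      adjacent : ∀ i → Adj G (vtx i) (vtx (next i))

  open ClosedWalk

  Traverses : (W : ClosedWalk) → Fin (suc (m W)) → Fin n → Fin n → Set
  Traverses W i x y =
    (vtx W i ≡ x × vtx W (next i) ≡ y) ⊎ (vtx W i ≡ y × vtx W (next i) ≡ x)

  TraversedExactlyTwice : ClosedWalk → Fin n → Fin n → Set
  TraversedExactlyTwice W x y =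
    ∃[ i ] ∃[ j ] (i ≢ j × Traverses W i x y × Traverses W j x y
                  × (∀ k → Traverses W k x y → k ≡ i ⊎ k ≡ j))

  record DoubleTrace : Set where
    field
      walk  : ClosedWalk
      twice : ∀ x y → Adj G x y → TraversedExactlyTwice walk x y

  Repetition : ClosedWalk → Fin n → Subset n → Set
  Repetition W v N =
    N ⊆ Nbhd G v ×
    (∀ i → vtx W i ≡ v →
       (vtx W (next i) ∈ N → vtx W (prev i) ∈ N) ×
       (vtx W (prev i) ∈ N → vtx W (next i) ∈ N))

  record StableTrace (d : ℕ) : Set where
    field
      trace  : DoubleTrace
      stable : ∀ v (N : Subset n) → 1 ≤ ∣ N ∣ → ∣ N ∣ ≤ d →
               ¬ Repetition (DoubleTrace.walk trace) v N

-- If deg v ≤ d, every closed walk has an N(v)-repetition at v, and connectivity gives deg v ≥ 1;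
-- so a d-stable trace forces δ(G) > d.
--
-- Conversely, grow a closed walk, kept as the cyclic sequence of its vertices, by one unused edge
-- uv at a time, with u on the walk: if v is new, insert the detour u v u; otherwise write the walk
-- as u A v B and replace it by u v Aʳ u v B.  Either way uv is traversed twice, no other traversal
-- changes, and at x ∈ {u, v} one transition z–x–h is replaced by z–x–y and y–x–h.  The invariant is
-- that at every vertex x each 2-colouring separating two neighbours reached from x is crossed by a
-- transition at x; it survives because a colouring separating z from h separates y from z or from h.
-- By connectivity the process only stops once every edge is used twice.  Then for 1 ≤ |N| ≤ d < deg v
-- the set N contains a neighbour of v and misses another, so the invariant forbids an N-repetition.

module Submission where

open import Defs
open import Data.Bool using (Bool; true) renaming (_≟_ to _≟ᵇ_)
open import Data.Empty using (⊥-elim)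
open import Data.Fin using (Fin; toℕ; fromℕ; inject₁; _≟_) renaming (zero to fzero; suc to fsuc)
open import Data.Fin.Properties using (toℕ-fromℕ<; toℕ-fromℕ; toℕ-inject₁; toℕ-injective; toℕ<n; any?)
open import Data.Fin.Subset using (Subset; ∣_∣; _⊆_; Nonempty) renaming (_∈_ to _∈ₛ_; _∉_ to _∉ₛ_)
open import Data.Fin.Subset.Properties
  using (nonempty?; Empty-unique; ∣⊥∣≡0; p⊆q⇒∣p∣≤∣q∣; ∣⁅x⁆∣≡1; x∈⁅y⁆⇒x≡y) renaming (_∈?_ to _∈ₛ?_)
open import Data.List
  using (List; []; _∷_; _++_; [_]; _∷ʳ_; reverse; map; length; filter; lookup; tabulate; applyUpTo; allFin; cartesianProduct)
open import Data.List.Properties using (unfold-reverse; ++-assoc; ++-identityʳ; map-tabulate; tabulate-cong; map-cong; map-∘)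
open import Data.List.Membership.Propositional using (_∈_; _∉_; lose)
open import Data.List.Membership.Propositional.Properties
  using (∈-++⁻; ∈-∃++; ∈-allFin; ∈-cartesianProduct⁺; ∈-map⁺; ∈-map⁻; ∈-lookup; ∈-filter⁺; ∈-filter⁻)
import Data.List.Membership.DecPropositional as DecMembership
open import Data.List.Relation.Binary.Permutation.Propositional as ↭ using (_↭_; ↭-refl; ↭-sym; ↭-trans; prep)
open import Data.List.Relation.Binary.Permutation.Propositional.Properties
  using (∈-resp-↭; Any-resp-↭; All-resp-↭; map⁺; ++-comm; ++⁺ˡ; ++⁺ʳ; ∷↭∷ʳ; shift; shifts; ↭-reverse)
open import Data.List.Relation.Binary.Pointwise as Pointwise using (Pointwise; []; _∷_)
open import Data.List.Relation.Unary.All as All using (All; []; _∷_)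
open import Data.List.Relation.Unary.AllPairs using ([]; _∷_)
open import Data.List.Relation.Unary.Any as Any using (Any; here; there; satisfied)
open import Data.List.Relation.Unary.Any.Properties using (map⁻)
open import Data.List.Relation.Unary.Unique.Propositional using (Unique)
open import Data.List.Relation.Unary.Unique.Propositional.Properties using (allFin⁺; filter⁺)
open import Data.Nat using (ℕ; zero; suc; _+_; _≤_; _<_; z≤n; s≤s) renaming (_≟_ to _≟ℕ_)
open import Data.Nat.DivMod using (_%_; m<n⇒m%n≡m; n%n≡0; [m+n]%n≡m%n)
open import Data.Nat.Properties
  using (1+n≢0; n<1+n; n≤1+n; <⇒≤; _<?_; ≮⇒≥; <-irrefl; <-trans; <-≤-trans; ≤-refl; ≤-reflexive; ≤-trans; ≤-pred;
         m≤n⇒m<n∨m≡n; +-comm; +-suc; +-assoc; +-identityʳ; +-mono-≤; +-mono-≤-<; m+n≡0⇒n≡0; +-commutativeSemigroup)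
open import Algebra.Properties.CommutativeSemigroup +-commutativeSemigroup using (x∙yz≈y∙xz)
open import Data.Product using (_×_; ∃-syntax; _,_; proj₁; proj₂; swap)
open import Data.Product.Properties using (≡-dec; ×-≡,≡→≡; ×-≡,≡←≡)
open import Data.Sum using (_⊎_; inj₁; inj₂; [_,_]′)
open import Data.Vec.Properties using (lookup∘tabulate; []=⇒lookup; lookup⇒[]=)
open import Function using (_∘_)
open import Function.Bundles using (_⇔_; mk⇔)
open import Relation.Binary.Definitions using (DecidableEquality)
open import Relation.Binary.PropositionalEquality
  using (_≡_; _≢_; refl; sym; trans; cong; cong₂; subst; subst₂; ≢-sym; module ≡-Reasoning)
open import Relation.Nullary using (¬_; Dec; yes; no)
open import Relation.Nullary.Decidable using (_×-dec_; _⊎-dec_; ¬?; map′; does; dec-true; dec-false; does-⇔)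

-- Windows of cyclic sequences

-- (predecessor , vertex , successor): the transition of a walk through a vertex
Window : Set → Set
Window A = A × A × A

module _ {A : Set} where

  reverseWindow : Window A → Window A
  reverseWindow (p , x , q) = (q , x , p)

  headOr : List A → A → A
  headOr []      h = h
  headOr (y ∷ _) _ = y

  lastOr : A → List A → A
  lastOr x []       = x
  lastOr x (y ∷ ys) = lastOr y ys

  -- The windows at the entries of ys, where x precedes ys and h follows it.
  windowsFrom : A → List A → A → List (Window A)
  windowsFrom x []       h = []
  windowsFrom x (y ∷ ys) h = (x , y , headOr ys h) ∷ windowsFrom y ys h

  windows : List A → List (Window A)
  windows []       = []
  windows (x ∷ xs) = (lastOr x xs , x , headOr xs x) ∷ windowsFrom x xs x

  headOr-++ : ∀ xs ys h → headOr (xs ++ ys) h ≡ headOr xs (headOr ys h)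
  headOr-++ []      ys h = refl
  headOr-++ (_ ∷ _) ys h = refl

  lastOr-++ : ∀ x xs y ys → lastOr x (xs ++ y ∷ ys) ≡ lastOr y ys
  lastOr-++ x []       y ys = refl
  lastOr-++ x (z ∷ xs) y ys = lastOr-++ z xs y ys

  windowsFrom-++ : ∀ x xs ys h →
    windowsFrom x (xs ++ ys) h ≡ windowsFrom x xs (headOr ys h) ++ windowsFrom (lastOr x xs) ys h
  windowsFrom-++ x []       ys h = refl
  windowsFrom-++ x (y ∷ xs) ys h =
    cong₂ _∷_ (cong (λ s → (x , y , s)) (headOr-++ xs ys h)) (windowsFrom-++ y xs ys h)

  lastOr-reverse : ∀ y xs → lastOr y (reverse xs) ≡ headOr xs y
  lastOr-reverse y []       = refl
  lastOr-reverse y (x ∷ xs) rewrite unfold-reverse x xs = lastOr-++ y (reverse xs) x []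

  headOr-reverse : ∀ y xs → headOr (reverse xs) y ≡ lastOr y xs
  headOr-reverse y []       = refl
  headOr-reverse y (x ∷ xs) rewrite unfold-reverse x xs =
    trans (headOr-++ (reverse xs) [ x ] y) (headOr-reverse x xs)

  windowsFrom-reverse : ∀ x xs y →
    windowsFrom y (reverse xs) x ≡ reverse (map reverseWindow (windowsFrom x xs y))
  windowsFrom-reverse x []       y = refl
  windowsFrom-reverse x (a ∷ as) y
    rewrite unfold-reverse a as
          | unfold-reverse (reverseWindow (x , a , headOr as y)) (map reverseWindow (windowsFrom a as y)) =
    trans (windowsFrom-++ y (reverse as) [ a ] x)
          (cong₂ _++_ (windowsFrom-reverse a as y)
                      (cong (λ s → (s , a , x) ∷ []) (lastOr-reverse y as)))

  windows-rotate₁ : ∀ x ys → windows (x ∷ ys) ↭ windows (ys ++ [ x ])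
  windows-rotate₁ x []       = ↭-refl
  windows-rotate₁ x (y ∷ ys)
    rewrite lastOr-++ y ys x [] | headOr-++ ys [ x ] y | windowsFrom-++ y ys [ x ] y =
    ∷↭∷ʳ (lastOr y ys , x , y) ((x , y , headOr ys x) ∷ windowsFrom y ys x)

  windows-rotate : ∀ xs ys → windows (xs ++ ys) ↭ windows (ys ++ xs)
  windows-rotate []       ys rewrite ++-identityʳ ys = ↭-refl
  windows-rotate (x ∷ xs) ys = ↭-trans (windows-rotate₁ x (xs ++ ys)) rotated
    where
    rotated : windows ((xs ++ ys) ++ [ x ]) ↭ windows (ys ++ x ∷ xs)
    rotated rewrite ++-assoc xs ys [ x ] =
      subst (λ l → windows (xs ++ ys ++ [ x ]) ↭ windows l) (++-assoc ys [ x ] xs)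
            (windows-rotate xs (ys ++ [ x ]))

  windows-detour : ∀ u v ys → windows (u ∷ v ∷ u ∷ ys) ≡
    (lastOr u ys , u , v) ∷ (u , v , u) ∷ (v , u , headOr ys u) ∷ windowsFrom u ys u
  windows-detour u v []      = refl
  windows-detour u v (_ ∷ _) = refl

  windows-split : ∀ u as v bs → windows (u ∷ as ++ v ∷ bs) ≡
    (lastOr v bs , u , headOr as v) ∷ windowsFrom u as v
      ++ (lastOr u as , v , headOr bs u) ∷ windowsFrom v bs u
  windows-split u as v bs
    rewrite lastOr-++ u as v bs | headOr-++ as (v ∷ bs) u | windowsFrom-++ u as (v ∷ bs) u = refl

  windows-reroute : ∀ u as v bs → windows (u ∷ v ∷ reverse as ++ u ∷ v ∷ bs) ≡
    (lastOr v bs , u , v) ∷ (u , v , lastOr u as) ∷ reverse (map reverseWindow (windowsFrom u as v))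
      ++ (headOr as v , u , v) ∷ (u , v , headOr bs u) ∷ windowsFrom v bs u
  windows-reroute u as v bs
    rewrite lastOr-++ v (reverse as) u (v ∷ bs) | headOr-++ (reverse as) (u ∷ v ∷ bs) u
          | headOr-reverse u as | windowsFrom-++ v (reverse as) (u ∷ v ∷ bs) u
          | windowsFrom-reverse u as v | lastOr-reverse v as = refl

  -- The window (p , x , q) uses the half-edges (x , p) and (x , q) of the edges xp and xq.
  halfEdges : List (Window A) → List (A × A)
  halfEdges []                  = []
  halfEdges ((p , x , q) ∷ ws) = (x , p) ∷ (x , q) ∷ halfEdges ws

  halfEdges-↭ : ∀ {ws ws'} → ws ↭ ws' → halfEdges ws ↭ halfEdges ws'
  halfEdges-↭ ↭.refl                                = ↭-refl
  halfEdges-↭ (prep (p , x , q) σ)                  = prep _ (prep _ (halfEdges-↭ σ))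
  halfEdges-↭ (↭.swap (p , x , q) (p' , x' , q') σ) =
    ↭-trans (shifts ((x , p) ∷ (x , q) ∷ []) ((x' , p') ∷ (x' , q') ∷ []))
            (prep _ (prep _ (prep _ (prep _ (halfEdges-↭ σ)))))
  halfEdges-↭ (↭.trans σ τ)                         = ↭-trans (halfEdges-↭ σ) (halfEdges-↭ τ)

  ∈-halfEdges⁻ : ∀ ws {x b} → (x , b) ∈ halfEdges ws →
    ∃[ p ] ∃[ q ] ((p , x , q) ∈ ws × (b ≡ p ⊎ b ≡ q))
  ∈-halfEdges⁻ ((p , x , q) ∷ ws) (here refl)         = p , q , here refl , inj₁ refl
  ∈-halfEdges⁻ ((p , x , q) ∷ ws) (there (here refl)) = p , q , here refl , inj₂ refl
  ∈-halfEdges⁻ (_ ∷ ws) (there (there b∈))            =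
    let p , q , w∈ , b≡ = ∈-halfEdges⁻ ws b∈ in p , q , there w∈ , b≡

  infix 4 _≋_
  _≋_ : List (Window A) → List (Window A) → Set
  _≋_ = Pointwise (λ w w' → w' ≡ w ⊎ w' ≡ reverseWindow w)

  ≋-reverseWindows : ∀ ws → ws ≋ map reverseWindow ws
  ≋-reverseWindows []       = []
  ≋-reverseWindows (w ∷ ws) = inj₂ refl ∷ ≋-reverseWindows ws

  halfEdges-≋ : ∀ {ws ws'} → ws ≋ ws' → halfEdges ws ↭ halfEdges ws'
  halfEdges-≋ []                  = ↭-refl
  halfEdges-≋ (inj₁ refl ∷ ws≋ws') = prep _ (prep _ (halfEdges-≋ ws≋ws'))
  halfEdges-≋ (inj₂ refl ∷ ws≋ws') = ↭.swap _ _ (halfEdges-≋ ws≋ws')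

  edgeHalves : A → A → List (A × A)
  edgeHalves u v = (u , v) ∷ (u , v) ∷ (v , u) ∷ (v , u) ∷ []

  detour-halfEdges : ∀ z u h v R →
    halfEdges ((z , u , v) ∷ (u , v , u) ∷ (v , u , h) ∷ R) ↭ edgeHalves u v ++ halfEdges ((z , u , h) ∷ R)
  detour-halfEdges z u h v R =
    ↭-trans (shifts [ (u , z) ] ((u , v) ∷ (v , u) ∷ (v , u) ∷ (u , v) ∷ []))
            (prep _ (shift (u , v) ((v , u) ∷ (v , u) ∷ []) _))

  reroute-halfEdges : ∀ z u a p v q M →
    halfEdges ((z , u , v) ∷ (a , u , v) ∷ (u , v , p) ∷ (u , v , q) ∷ M)
      ↭ edgeHalves u v ++ halfEdges ((z , u , a) ∷ (p , v , q) ∷ M)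
  reroute-halfEdges z u a p v q M =
    ↭-trans (shifts [ (u , z) ] [ (u , v) ])
    (↭-trans (prep _ (shift (u , v) ((u , z) ∷ (u , a) ∷ []) _))
    (↭-trans (prep _ (prep _ (shift (v , u) ((u , z) ∷ (u , a) ∷ []) _)))
             (prep _ (prep _ (prep _ (shift (v , u) ((u , z) ∷ (u , a) ∷ (v , p) ∷ []) _))))))

-- Cyclic sequences as closed walks

toℕ-next : ∀ {m} (i : Fin (suc m)) → toℕ i < m → toℕ (next i) ≡ suc (toℕ i)
toℕ-next i i<m = trans (toℕ-fromℕ< _) (m<n⇒m%n≡m (s≤s i<m))

toℕ-next-last : ∀ {m} (i : Fin (suc m)) → toℕ i ≡ m → toℕ (next i) ≡ 0
toℕ-next-last {m} i i≡m = begin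
  toℕ (next i)          ≡⟨ toℕ-fromℕ< _ ⟩
  suc (toℕ i) % suc m   ≡⟨ cong (λ k → suc k % suc m) i≡m ⟩
  suc m % suc m         ≡⟨ n%n≡0 (suc m) ⟩
  0                     ∎
  where open ≡-Reasoning

toℕ-prev-zero : ∀ {m} → toℕ (prev {m} fzero) ≡ m
toℕ-prev-zero {m} = trans (toℕ-fromℕ< _) (m<n⇒m%n≡m (n<1+n m))

toℕ-prev-suc : ∀ {m} (j : Fin m) → toℕ (prev (fsuc j)) ≡ toℕ j
toℕ-prev-suc {m} j = begin
  toℕ (prev (fsuc j))           ≡⟨ toℕ-fromℕ< _ ⟩
  (suc (toℕ j) + m) % suc m     ≡⟨ cong (_% suc m) (sym (+-suc (toℕ j) m)) ⟩
  (toℕ j + suc m) % suc m       ≡⟨ [m+n]%n≡m%n (toℕ j) (suc m) ⟩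
  toℕ j % suc m                 ≡⟨ m<n⇒m%n≡m (<-trans (toℕ<n j) (n<1+n m)) ⟩
  toℕ j                         ∎
  where open ≡-Reasoning

next-prev : ∀ {m} (i : Fin (suc m)) → next (prev i) ≡ i
next-prev fzero    = toℕ-injective (toℕ-next-last (prev fzero) toℕ-prev-zero)
next-prev {m} (fsuc j) = toℕ-injective (trans
  (toℕ-next (prev (fsuc j)) (subst (_< m) (sym (toℕ-prev-suc j)) (toℕ<n j)))
  (cong suc (toℕ-prev-suc j)))

tabulate-∷ʳ : ∀ {B : Set} {m} (f : Fin (suc m) → B) →
  tabulate f ≡ tabulate (λ i → f (inject₁ i)) ∷ʳ f (fromℕ m)
tabulate-∷ʳ {m = zero}  f = refl
tabulate-∷ʳ {m = suc m} f = cong (f fzero ∷_) (tabulate-∷ʳ (λ i → f (fsuc i)))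

map-prev-allFin : ∀ m → map (prev {m}) (allFin (suc m)) ↭ allFin (suc m)
map-prev-allFin m = subst₂ _↭_ (sym map-prev≡) (sym (tabulate-∷ʳ {m = m} (λ i → i)))
                      (∷↭∷ʳ (fromℕ m) (tabulate inject₁))
  where
  map-prev≡ : map prev (allFin (suc m)) ≡ fromℕ m ∷ tabulate inject₁
  map-prev≡ = trans (map-tabulate (λ i → i) prev)
    (cong₂ _∷_ (toℕ-injective (trans toℕ-prev-zero (sym (toℕ-fromℕ m))))
               (tabulate-cong (λ j → toℕ-injective (trans (toℕ-prev-suc j) (sym (toℕ-inject₁ j))))))

module _ {A : Set} where

  nth : List A → ℕ → A → A
  nth []       _       d = d
  nth (x ∷ xs) zero    d = x
  nth (x ∷ xs) (suc k) d = nth xs k d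

  lookup-nth : ∀ xs (i : Fin (length xs)) d → lookup xs i ≡ nth xs (toℕ i) d
  lookup-nth (x ∷ xs) fzero    d = refl
  lookup-nth (x ∷ xs) (fsuc i) d = lookup-nth xs i d

  headOr-nth : ∀ ys h → headOr ys h ≡ nth ys 0 h
  headOr-nth []      h = refl
  headOr-nth (_ ∷ _) h = refl

  nth-length : ∀ xs d → nth xs (length xs) d ≡ d
  nth-length []       d = refl
  nth-length (x ∷ xs) d = nth-length xs d

  nth-last : ∀ x xs d → nth (x ∷ xs) (length xs) d ≡ lastOr x xs
  nth-last x []       d = refl
  nth-last x (y ∷ ys) d = nth-last y ys d

  windowsFrom-nth : ∀ x ys h → windowsFrom x ys h ≡
    applyUpTo (λ j → (nth (x ∷ ys) j h , nth ys j h , nth ys (suc j) h)) (length ys)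
  windowsFrom-nth x []       h = refl
  windowsFrom-nth x (y ∷ ys) h =
    cong₂ _∷_ (cong (λ s → (x , y , s)) (headOr-nth ys h)) (windowsFrom-nth y ys h)

  tabulate-applyUpTo : ∀ {m} (f : Fin m → Window A) (g : ℕ → Window A) →
    (∀ j → f j ≡ g (toℕ j)) → tabulate f ≡ applyUpTo g m
  tabulate-applyUpTo {zero}  f g f≗g = refl
  tabulate-applyUpTo {suc m} f g f≗g =
    cong₂ _∷_ (f≗g fzero) (tabulate-applyUpTo (λ j → f (fsuc j)) (λ k → g (suc k)) (λ j → f≗g (fsuc j)))

  module AsClosedWalk (x₀ : A) (xs₀ : List A) where

    cycle : List A
    cycle = x₀ ∷ xs₀

    at : Fin (suc (length xs₀)) → A
    at = lookup cycle

    windowAt : Fin (suc (length xs₀)) → Window A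
    windowAt i = (at (prev i) , at i , at (next i))

    at-nth : ∀ i → at i ≡ nth cycle (toℕ i) x₀
    at-nth i = lookup-nth cycle i x₀

    at-next : ∀ i → at (next i) ≡ nth cycle (suc (toℕ i)) x₀
    at-next i with m≤n⇒m<n∨m≡n (≤-pred (toℕ<n i))
    ... | inj₁ i<m = trans (at-nth (next i)) (cong (λ k → nth cycle k x₀) (toℕ-next i i<m))
    ... | inj₂ i≡m = trans (at-nth (next i)) (trans (cong (λ k → nth cycle k x₀) (toℕ-next-last i i≡m))
                       (subst (λ k → x₀ ≡ nth xs₀ k x₀) (sym i≡m) (sym (nth-length xs₀ x₀))))

    windows-as-map : windows cycle ≡ map windowAt (allFin (suc (length xs₀)))
    windows-as-map = sym (trans (map-tabulate (λ i → i) windowAt) (cong₂ _∷_ first rest))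
      where
      triple : ∀ {a a' b b' c c' : A} → a ≡ a' → b ≡ b' → c ≡ c' → (a , b , c) ≡ (a' , b' , c')
      triple refl refl refl = refl
      first : windowAt fzero ≡ (lastOr x₀ xs₀ , x₀ , headOr xs₀ x₀)
      first = triple
        (trans (at-nth (prev fzero)) (trans (cong (λ k → nth cycle k x₀) (toℕ-prev-zero {length xs₀})) (nth-last x₀ xs₀ x₀)))
        refl
        (trans (at-next fzero) (sym (headOr-nth xs₀ x₀)))
      rest : tabulate (λ j → windowAt (fsuc j)) ≡ windowsFrom x₀ xs₀ x₀
      rest = trans
        (tabulate-applyUpTo _ _ (λ j → triple
          (trans (at-nth (prev (fsuc j))) (cong (λ k → nth cycle k x₀) (toℕ-prev-suc j)))
          (at-nth (fsuc j))
          (at-next (fsuc j))))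
        (sym (windowsFrom-nth x₀ xs₀ x₀))

    halfEdges-∈ : ∀ {x b} → (x , b) ∈ halfEdges (windows cycle) → x ∈ cycle × b ∈ cycle
    halfEdges-∈ {x} xb∈ with ∈-halfEdges⁻ (windows cycle) xb∈
    ... | p , q , w∈ , b≡ with ∈-map⁻ windowAt (subst ((p , x , q) ∈_) windows-as-map w∈)
    ...   | i , _ , refl = ∈-lookup i , [ (λ { refl → ∈-lookup (prev i) }) , (λ { refl → ∈-lookup (next i) }) ]′ b≡

indicator : ∀ {P : Set} → Dec P → ℕ
indicator (yes _) = 1
indicator (no _)  = 0

indicator-mono : ∀ {P Q : Set} (p : Dec P) (q : Dec Q) → (P → Q) → indicator p ≤ indicator q
indicator-mono (yes p) (yes _) _   = ≤-refl
indicator-mono (yes p) (no ¬q) p→q = ⊥-elim (¬q (p→q p))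
indicator-mono (no _)  _       _   = z≤n

countZeros : ∀ {A : Set} → (A → ℕ) → List A → ℕ
countZeros f []       = 0
countZeros f (x ∷ xs) = indicator (f x ≟ℕ 0) + countZeros f xs

module _ {A : Set} {f g : A → ℕ} (zeros⊆ : ∀ x → g x ≡ 0 → f x ≡ 0) where

  countZeros-mono : ∀ xs → countZeros g xs ≤ countZeros f xs
  countZeros-mono []       = z≤n
  countZeros-mono (x ∷ xs) = +-mono-≤ (indicator-mono (g x ≟ℕ 0) (f x ≟ℕ 0) (zeros⊆ x)) (countZeros-mono xs)

  countZeros-strict : ∀ {y} → f y ≡ 0 → g y ≢ 0 → ∀ {xs} → y ∈ xs → countZeros g xs < countZeros f xs
  countZeros-strict {y} fy≡0 gy≢0 {_ ∷ xs} (here refl) with g y ≟ℕ 0 | f y ≟ℕ 0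
  ... | yes gy≡0 | _         = ⊥-elim (gy≢0 gy≡0)
  ... | no _     | no fy≢0  = ⊥-elim (fy≢0 fy≡0)
  ... | no _     | yes _    = s≤s (countZeros-mono xs)
  countZeros-strict fy≡0 gy≢0 {x ∷ _} (there y∈) =
    +-mono-≤-< (indicator-mono (g x ≟ℕ 0) (f x ≟ℕ 0) (zeros⊆ x)) (countZeros-strict fy≡0 gy≢0 y∈)

module _ (G : Graph) where
  open Graph G using (n)
  open DecMembership (_≟_ {n}) using (_∈?_)

  Vertex : Set
  Vertex = Fin n

  HalfEdge : Set
  HalfEdge = Vertex × Vertex

  adj-sym : ∀ {x y} → Adj G x y → Adj G y x
  adj-sym {x} {y} xy = trans (Graph.sym G y x) xy

  adj⇒≢ : ∀ {x y} → Adj G x y → x ≢ y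
  adj⇒≢ {x} xx refl with trans (sym (Graph.irrefl G x)) xx
  ... | ()

  _≟ʰ_ : DecidableEquality HalfEdge
  _≟ʰ_ = ≡-dec _≟_ _≟_

  multiplicity : HalfEdge → List HalfEdge → ℕ
  multiplicity t []       = 0
  multiplicity t (e ∷ es) = indicator (e ≟ʰ t) + multiplicity t es

  multiplicity-++ : ∀ t es fs → multiplicity t (es ++ fs) ≡ multiplicity t es + multiplicity t fs
  multiplicity-++ t []       fs = refl
  multiplicity-++ t (e ∷ es) fs =
    trans (cong (indicator (e ≟ʰ t) +_) (multiplicity-++ t es fs)) (sym (+-assoc (indicator (e ≟ʰ t)) _ _))

  multiplicity-↭ : ∀ t {es fs} → es ↭ fs → multiplicity t es ≡ multiplicity t fs
  multiplicity-↭ t ↭.refl         = refl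
  multiplicity-↭ t (prep e σ)     = cong (indicator (e ≟ʰ t) +_) (multiplicity-↭ t σ)
  multiplicity-↭ t (↭.swap e f σ) =
    trans (x∙yz≈y∙xz (indicator (e ≟ʰ t)) (indicator (f ≟ʰ t)) _)
          (cong (λ k → indicator (f ≟ʰ t) + (indicator (e ≟ʰ t) + k)) (multiplicity-↭ t σ))
  multiplicity-↭ t (↭.trans σ τ) = trans (multiplicity-↭ t σ) (multiplicity-↭ t τ)

  multiplicity≢0⇒∈ : ∀ t es → multiplicity t es ≢ 0 → t ∈ es
  multiplicity≢0⇒∈ t []       m≢0 = ⊥-elim (m≢0 refl)
  multiplicity≢0⇒∈ t (e ∷ es) m≢0 with e ≟ʰ t
  ... | yes refl = here refl
  ... | no _     = there (multiplicity≢0⇒∈ t es m≢0)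

  multiplicity-map-swap : ∀ t es → multiplicity (swap t) (map swap es) ≡ multiplicity t es
  multiplicity-map-swap t []       = refl
  multiplicity-map-swap t (e ∷ es) = cong₂ _+_ (indicator-swap e) (multiplicity-map-swap t es)
    where
    indicator-swap : ∀ e → indicator (swap e ≟ʰ swap t) ≡ indicator (e ≟ʰ t)
    indicator-swap e with swap e ≟ʰ swap t | e ≟ʰ t
    ... | yes _  | yes _  = refl
    ... | no _   | no _   = refl
    ... | yes se | no e≢t = ⊥-elim (e≢t (cong swap se))
    ... | no se≢ | yes e  = ⊥-elim (se≢ (cong swap e))

  multiplicity-edgeHalves-swap : ∀ u v x y →
    multiplicity (y , x) (edgeHalves u v) ≡ multiplicity (x , y) (edgeHalves u v)
  multiplicity-edgeHalves-swap u v x y =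
    trans (multiplicity-↭ (y , x) (++-comm ((u , v) ∷ (u , v) ∷ []) ((v , u) ∷ (v , u) ∷ [])))
          (multiplicity-map-swap (x , y) (edgeHalves u v))

  multiplicity-edgeHalves : ∀ {u v} → u ≢ v → multiplicity (u , v) (edgeHalves u v) ≡ 2
  multiplicity-edgeHalves {u} {v} u≢v with (u , v) ≟ʰ (u , v) | (v , u) ≟ʰ (u , v)
  ... | yes _  | no _    = refl
  ... | no uv≢ | _       = ⊥-elim (uv≢ refl)
  ... | yes _  | yes vu≡ = ⊥-elim (u≢v (cong proj₂ vu≡))

  multiplicity-edgeHalves-other : ∀ {u v} t → t ≢ (u , v) → t ≢ (v , u) → multiplicity t (edgeHalves u v) ≡ 0
  multiplicity-edgeHalves-other {u} {v} t t≢uv t≢vu with (u , v) ≟ʰ t | (v , u) ≟ʰ t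
  ... | no _     | no _     = refl
  ... | yes uv≡t | _        = ⊥-elim (t≢uv (sym uv≡t))
  ... | _        | yes vu≡t = ⊥-elim (t≢vu (sym vu≡t))

  coverage : List (Window Vertex) → HalfEdge → ℕ
  coverage ws t = multiplicity t (halfEdges ws)

  -- The invariant

  AdjacentWindow : Window Vertex → Set
  AdjacentWindow (p , x , q) = Adj G x p × Adj G x q

  -- Subsets N of neighbours are represented by their characteristic colourings.
  Colouring : Set
  Colouring = Vertex → Bool

  CrossesAt : Vertex → Colouring → Window Vertex → Set
  CrossesAt x σ (p , y , q) = y ≡ x × σ p ≢ σ q

  -- The walk has no N-repetition at x for any N containing some, but not all, neighbours reached from x.
  CutsCrossedAt : List (Window Vertex) → Vertex → Set
  CutsCrossedAt ws x = ∀ σ {a b} → (x , a) ∈ halfEdges ws → (x , b) ∈ halfEdges ws → σ a ≢ σ b →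
                       Any (CrossesAt x σ) ws

  record Invariant (ws : List (Window Vertex)) : Set where
    field
      windowsAdjacent : All AdjacentWindow ws
      coverage-0∨2    : ∀ t → coverage ws t ≡ 0 ⊎ coverage ws t ≡ 2
      coverage-sym    : ∀ x y → coverage ws (x , y) ≡ coverage ws (y , x)
      cutsCrossed     : ∀ x → CutsCrossedAt ws x
  open Invariant

  Invariant-[] : Invariant []
  Invariant-[] = record
    { windowsAdjacent = [] ; coverage-0∨2 = λ _ → inj₁ refl ; coverage-sym = λ _ _ → refl ; cutsCrossed = λ _ _ () }

  Invariant-resp : ∀ {ws ws'} → halfEdges ws ↭ halfEdges ws' →
    (All AdjacentWindow ws → All AdjacentWindow ws') →
    (∀ {x σ} → Any (CrossesAt x σ) ws → Any (CrossesAt x σ) ws') →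
    Invariant ws → Invariant ws'
  Invariant-resp {ws} {ws'} halves adjacent⁺ crossing⁺ I = record
    { windowsAdjacent = adjacent⁺ (windowsAdjacent I)
    ; coverage-0∨2    = λ t → subst (λ k → k ≡ 0 ⊎ k ≡ 2) (same t) (coverage-0∨2 I t)
    ; coverage-sym    = λ x y → trans (sym (same (x , y))) (trans (coverage-sym I x y) (same (y , x)))
    ; cutsCrossed     = λ x σ a∈ b∈ σa≢σb →
        crossing⁺ (cutsCrossed I x σ (∈-resp-↭ (↭-sym halves) a∈) (∈-resp-↭ (↭-sym halves) b∈) σa≢σb)
    }
    where
    same : ∀ t → coverage ws t ≡ coverage ws' t
    same t = multiplicity-↭ t halves

  Invariant-↭ : ∀ {ws ws'} → ws ↭ ws' → Invariant ws → Invariant ws'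
  Invariant-↭ σ = Invariant-resp (halfEdges-↭ σ) (All-resp-↭ σ) (Any-resp-↭ σ)

  Invariant-≋ : ∀ {ws ws'} → ws ≋ ws' → Invariant ws → Invariant ws'
  Invariant-≋ r = Invariant-resp (halfEdges-≋ r) (adjacent-≋ r) (crossing-≋ r)
    where
    adjacent-≋ : ∀ {ws ws'} → ws ≋ ws' → All AdjacentWindow ws → All AdjacentWindow ws'
    adjacent-≋ []                []                = []
    adjacent-≋ (inj₁ refl ∷ r)   (a ∷ as)          = a ∷ adjacent-≋ r as
    adjacent-≋ (inj₂ refl ∷ r)   ((xp , xq) ∷ as) = (xq , xp) ∷ adjacent-≋ r as
    crossing-≋ : ∀ {x σ ws ws'} → ws ≋ ws' → Any (CrossesAt x σ) ws → Any (CrossesAt x σ) ws'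
    crossing-≋ (inj₁ refl ∷ r) (here c)              = here c
    crossing-≋ (inj₂ refl ∷ r) (here (y≡x , σp≢σq)) = here (y≡x , ≢-sym σp≢σq)
    crossing-≋ (_ ∷ r)         (there c)             = there (crossing-≋ r c)

  -- Replacing the transition z–x–h by the two transitions z–x–y and h–x–y keeps every cut at x crossed.
  cutsCrossed-insert : ∀ {x y z h old ws} → CutsCrossedAt old x → (x , z) ∈ halfEdges old →
    (∀ σ → σ z ≢ σ y → Any (CrossesAt x σ) ws) →
    (∀ σ → σ h ≢ σ y → Any (CrossesAt x σ) ws) →
    (∀ σ → σ z ≡ σ h → Any (CrossesAt x σ) old → Any (CrossesAt x σ) ws) →
    (∀ {b} → (x , b) ∈ halfEdges ws → (x , b) ∈ halfEdges old ⊎ b ≡ y) →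
    CutsCrossedAt ws x
  cutsCrossed-insert {x} {y} {z} {h} {old} {ws} crossed z∈ zy hy kept uses σ {a} {b} a∈ b∈ σa≢σb
    with σ z ≟ᵇ σ y | σ h ≟ᵇ σ y
  ... | no σz≢σy | _         = zy σ σz≢σy
  ... | yes _    | no σh≢σy = hy σ σh≢σy
  ... | yes σz≡σy | yes σh≡σy = crossingVia (coloured-unlike-z (σ a ≟ᵇ σ z))
    where
    coloured-unlike-z : Dec (σ a ≡ σ z) → ∃[ c ] ((x , c) ∈ halfEdges ws × σ z ≢ σ c)
    coloured-unlike-z (yes σa≡σz) = b , b∈ , λ σz≡σb → σa≢σb (trans σa≡σz σz≡σb)
    coloured-unlike-z (no σa≢σz)  = a , a∈ , ≢-sym σa≢σz
    crossingVia : ∃[ c ] ((x , c) ∈ halfEdges ws × σ z ≢ σ c) → Any (CrossesAt x σ) ws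
    crossingVia (c , c∈ , σz≢σc) with uses c∈
    ... | inj₂ refl   = ⊥-elim (σz≢σc σz≡σy)
    ... | inj₁ c∈old = kept σ (trans σz≡σy (sym σh≡σy)) (crossed σ z∈ c∈old σz≢σc)

  cutsCrossed-preserved : ∀ {x old ws} → CutsCrossedAt old x →
    (∀ {σ} → Any (CrossesAt x σ) old → Any (CrossesAt x σ) ws) →
    (∀ {b} → (x , b) ∈ halfEdges ws → (x , b) ∈ halfEdges old) →
    CutsCrossedAt ws x
  cutsCrossed-preserved crossed kept uses σ a∈ b∈ σa≢σb = kept (crossed σ (uses a∈) (uses b∈) σa≢σb)

  cutsCrossed-single : ∀ {x ws} → (∀ {a b} → (x , a) ∈ halfEdges ws → (x , b) ∈ halfEdges ws → a ≡ b) →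
    CutsCrossedAt ws x
  cutsCrossed-single same σ a∈ b∈ σa≢σb = ⊥-elim (σa≢σb (cong σ (same a∈ b∈)))

  AddsEdge : Vertex → Vertex → List (Window Vertex) → List (Window Vertex) → Set
  AddsEdge u v old new = halfEdges new ↭ edgeHalves u v ++ halfEdges old

  module _ {u v old new} (adds : AddsEdge u v old new) where

    coverage-addsEdge : ∀ t → coverage new t ≡ multiplicity t (edgeHalves u v) + coverage old t
    coverage-addsEdge t = trans (multiplicity-↭ t adds) (multiplicity-++ t (edgeHalves u v) (halfEdges old))

    coverage-monotone : ∀ t → coverage new t ≡ 0 → coverage old t ≡ 0
    coverage-monotone t new≡0 = m+n≡0⇒n≡0 (multiplicity t (edgeHalves u v)) (trans (sym (coverage-addsEdge t)) new≡0)

    uses-addsEdge : ∀ {x b} → (x , b) ∈ halfEdges new →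
      (x , b) ∈ halfEdges old ⊎ (x , b) ≡ (u , v) ⊎ (x , b) ≡ (v , u)
    uses-addsEdge xb∈ with ∈-++⁻ (edgeHalves u v) (∈-resp-↭ adds xb∈)
    ... | inj₂ xb∈old                          = inj₁ xb∈old
    ... | inj₁ (here xb≡uv)                    = inj₂ (inj₁ xb≡uv)
    ... | inj₁ (there (here xb≡uv))            = inj₂ (inj₁ xb≡uv)
    ... | inj₁ (there (there (here xb≡vu)))    = inj₂ (inj₂ xb≡vu)
    ... | inj₁ (there (there (there (here xb≡vu)))) = inj₂ (inj₂ xb≡vu)

    uses-at-source : u ≢ v → ∀ {b} → (u , b) ∈ halfEdges new → (u , b) ∈ halfEdges old ⊎ b ≡ v
    uses-at-source u≢v ub∈ with uses-addsEdge ub∈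
    ... | inj₁ ub∈old      = inj₁ ub∈old
    ... | inj₂ (inj₁ refl) = inj₂ refl
    ... | inj₂ (inj₂ refl) = ⊥-elim (u≢v refl)

    uses-at-target : u ≢ v → ∀ {b} → (v , b) ∈ halfEdges new → (v , b) ∈ halfEdges old ⊎ b ≡ u
    uses-at-target u≢v vb∈ with uses-addsEdge vb∈
    ... | inj₁ vb∈old      = inj₁ vb∈old
    ... | inj₂ (inj₁ refl) = ⊥-elim (u≢v refl)
    ... | inj₂ (inj₂ refl) = inj₂ refl

    uses-elsewhere : ∀ {x} → x ≢ u → x ≢ v → ∀ {b} → (x , b) ∈ halfEdges new → (x , b) ∈ halfEdges old
    uses-elsewhere x≢u x≢v xb∈ with uses-addsEdge xb∈
    ... | inj₁ xb∈old      = xb∈old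
    ... | inj₂ (inj₁ refl) = ⊥-elim (x≢u refl)
    ... | inj₂ (inj₂ refl) = ⊥-elim (x≢v refl)

    coverage-added : u ≢ v → coverage old (u , v) ≡ 0 → coverage new (u , v) ≡ 2
    coverage-added u≢v uv≡0 = begin
      coverage new (u , v)                                    ≡⟨ coverage-addsEdge (u , v) ⟩
      multiplicity (u , v) (edgeHalves u v) + coverage old (u , v) ≡⟨ cong (multiplicity (u , v) (edgeHalves u v) +_) uv≡0 ⟩
      multiplicity (u , v) (edgeHalves u v) + 0               ≡⟨ +-identityʳ _ ⟩
      multiplicity (u , v) (edgeHalves u v)                   ≡⟨ multiplicity-edgeHalves u≢v ⟩
      2                                                       ∎
      where open ≡-Reasoning

    Invariant-addsEdge : Invariant old → u ≢ v → coverage old (u , v) ≡ 0 →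
      All AdjacentWindow new → (∀ x → CutsCrossedAt new x) → Invariant new
    Invariant-addsEdge I u≢v uv≡0 adjacent-new crossed-new = record
      { windowsAdjacent = adjacent-new
      ; coverage-0∨2    = coverage-0∨2-new
      ; coverage-sym    = coverage-sym-new
      ; cutsCrossed     = crossed-new
      }
      where
      open ≡-Reasoning
      coverage-sym-new : ∀ x y → coverage new (x , y) ≡ coverage new (y , x)
      coverage-sym-new x y = begin
        coverage new (x , y)                                         ≡⟨ coverage-addsEdge (x , y) ⟩
        multiplicity (x , y) (edgeHalves u v) + coverage old (x , y) ≡⟨ cong₂ _+_ (sym (multiplicity-edgeHalves-swap u v x y)) (coverage-sym I x y) ⟩
        multiplicity (y , x) (edgeHalves u v) + coverage old (y , x) ≡⟨ sym (coverage-addsEdge (y , x)) ⟩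
        coverage new (y , x)                                         ∎
      coverage-0∨2-new : ∀ t → coverage new t ≡ 0 ⊎ coverage new t ≡ 2
      coverage-0∨2-new t with t ≟ʰ (u , v) | t ≟ʰ (v , u)
      ... | yes refl | _        = inj₂ (coverage-added u≢v uv≡0)
      ... | no _     | yes refl = inj₂ (trans (coverage-sym-new v u) (coverage-added u≢v uv≡0))
      ... | no t≢uv  | no t≢vu  = subst (λ k → k ≡ 0 ⊎ k ≡ 2) (sym unchanged) (coverage-0∨2 I t)
        where
        unchanged : coverage new t ≡ coverage old t
        unchanged = trans (coverage-addsEdge t)
                          (cong (_+ coverage old t) (multiplicity-edgeHalves-other t t≢uv t≢vu))

  detour-invariant : ∀ {z u h v R} → Invariant ((z , u , h) ∷ R) → Adj G u v →
    (∀ {b} → (v , b) ∉ halfEdges ((z , u , h) ∷ R)) → coverage ((z , u , h) ∷ R) (u , v) ≡ 0 →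
    Invariant ((z , u , v) ∷ (u , v , u) ∷ (v , u , h) ∷ R)
  detour-invariant {z} {u} {h} {v} {R} I uv v-unused uv≡0 =
    Invariant-addsEdge adds I u≢v uv≡0 adjacent-new crossed
    where
    adds = detour-halfEdges z u h v R
    u≢v = adj⇒≢ uv
    adjacent-new : All AdjacentWindow ((z , u , v) ∷ (u , v , u) ∷ (v , u , h) ∷ R)
    adjacent-new with windowsAdjacent I
    ... | (uz , uh) ∷ rest = (uz , uv) ∷ (adj-sym uv , adj-sym uv) ∷ (uv , uh) ∷ rest
    only-u : ∀ {b} → (v , b) ∈ halfEdges ((z , u , v) ∷ (u , v , u) ∷ (v , u , h) ∷ R) → b ≡ u
    only-u vb∈ with uses-at-target adds u≢v vb∈
    ... | inj₁ vb∈old = ⊥-elim (v-unused vb∈old)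
    ... | inj₂ b≡u    = b≡u
    crossed : ∀ x → CutsCrossedAt ((z , u , v) ∷ (u , v , u) ∷ (v , u , h) ∷ R) x
    crossed x with x ≟ u | x ≟ v
    ... | yes refl | _ = cutsCrossed-insert (cutsCrossed I u) (here refl)
      (λ σ σz≢σv → here (refl , σz≢σv))
      (λ σ σh≢σv → there (there (here (refl , ≢-sym σh≢σv))))
      (λ { σ σz≡σh (here (_ , σz≢σh)) → ⊥-elim (σz≢σh σz≡σh) ; σ _ (there c) → there (there (there c)) })
      (uses-at-source adds u≢v)
    ... | no _ | yes refl = cutsCrossed-single (λ a∈ b∈ → trans (only-u a∈) (sym (only-u b∈)))
    ... | no x≢u | no x≢v = cutsCrossed-preserved (cutsCrossed I x)
      (λ { (here (u≡x , _)) → ⊥-elim (x≢u (sym u≡x)) ; (there c) → there (there (there c)) })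
      (uses-elsewhere adds x≢u x≢v)

  reroute-invariant : ∀ {z u a p v q M} → Invariant ((z , u , a) ∷ (p , v , q) ∷ M) → Adj G u v →
    coverage ((z , u , a) ∷ (p , v , q) ∷ M) (u , v) ≡ 0 →
    Invariant ((z , u , v) ∷ (a , u , v) ∷ (u , v , p) ∷ (u , v , q) ∷ M)
  reroute-invariant {z} {u} {a} {p} {v} {q} {M} I uv uv≡0 =
    Invariant-addsEdge adds I u≢v uv≡0 adjacent-new crossed
    where
    adds = reroute-halfEdges z u a p v q M
    u≢v = adj⇒≢ uv
    adjacent-new : All AdjacentWindow ((z , u , v) ∷ (a , u , v) ∷ (u , v , p) ∷ (u , v , q) ∷ M)
    adjacent-new with windowsAdjacent I
    ... | (uz , ua) ∷ (vp , vq) ∷ rest =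
      (uz , uv) ∷ (ua , uv) ∷ (adj-sym uv , vp) ∷ (adj-sym uv , vq) ∷ rest
    crossed : ∀ x → CutsCrossedAt ((z , u , v) ∷ (a , u , v) ∷ (u , v , p) ∷ (u , v , q) ∷ M) x
    crossed x with x ≟ u | x ≟ v
    ... | yes refl | _ = cutsCrossed-insert (cutsCrossed I u) (here refl)
      (λ σ σz≢σv → here (refl , σz≢σv))
      (λ σ σa≢σv → there (here (refl , σa≢σv)))
      (λ { σ σz≡σa (here (_ , σz≢σa)) → ⊥-elim (σz≢σa σz≡σa)
         ; σ _ (there (here (v≡u , _))) → ⊥-elim (u≢v (sym v≡u))
         ; σ _ (there (there c)) → there (there (there (there c))) })
      (uses-at-source adds u≢v)
    ... | no _ | yes refl = cutsCrossed-insert (cutsCrossed I v) (there (there (here refl)))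
      (λ σ σp≢σu → there (there (here (refl , ≢-sym σp≢σu))))
      (λ σ σq≢σu → there (there (there (here (refl , ≢-sym σq≢σu)))))
      (λ { σ _ (here (u≡v , _)) → ⊥-elim (u≢v u≡v)
         ; σ σp≡σq (there (here (_ , σp≢σq))) → ⊥-elim (σp≢σq σp≡σq)
         ; σ _ (there (there c)) → there (there (there (there c))) })
      (uses-at-target adds u≢v)
    ... | no x≢u | no x≢v = cutsCrossed-preserved (cutsCrossed I x)
      (λ { (here (u≡x , _)) → ⊥-elim (x≢u (sym u≡x))
         ; (there (here (v≡x , _))) → ⊥-elim (x≢v (sym v≡x))
         ; (there (there c)) → there (there (there (there c))) })
      (uses-elsewhere adds x≢u x≢v)

  -- Growing the walk

  coverage-↭ : ∀ {ws ws'} → ws ↭ ws' → ∀ t → coverage ws t ≡ coverage ws' t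
  coverage-↭ σ t = multiplicity-↭ t (halfEdges-↭ σ)

  record Extension (c : List Vertex) (u v : Vertex) : Set where
    field
      start     : Vertex
      rest      : List Vertex
      invariant : Invariant (windows (start ∷ rest))
      adds      : AddsEdge u v (windows c) (windows (start ∷ rest))

  detour : ∀ {u v} ys → v ∉ ys → Invariant (windows (u ∷ ys)) → Adj G u v →
    coverage (windows (u ∷ ys)) (u , v) ≡ 0 → Extension (u ∷ ys) u v
  detour {u} {v} ys v∉ys I uv uv≡0 = record
    { start     = u
    ; rest      = v ∷ u ∷ ys
    ; invariant = subst Invariant (sym (windows-detour u v ys)) (detour-invariant I uv v-unused uv≡0)
    ; adds      = subst (AddsEdge u v (windows (u ∷ ys))) (sym (windows-detour u v ys))
                        (detour-halfEdges _ u _ v _)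
    }
    where
    v-unused : ∀ {b} → (v , b) ∉ halfEdges (windows (u ∷ ys))
    v-unused vb∈ with proj₁ (AsClosedWalk.halfEdges-∈ u ys vb∈)
    ... | here v≡u   = adj⇒≢ uv (sym v≡u)
    ... | there v∈ys = v∉ys v∈ys

  reroute : ∀ {u v} as bs → Invariant (windows (u ∷ as ++ v ∷ bs)) → Adj G u v →
    coverage (windows (u ∷ as ++ v ∷ bs)) (u , v) ≡ 0 → Extension (u ∷ as ++ v ∷ bs) u v
  reroute {u} {v} as bs I uv uv≡0 = record
    { start     = u
    ; rest      = v ∷ reverse as ++ u ∷ v ∷ bs
    ; invariant = Invariant-↭ new-↭ (Invariant-≋ new-≋
                    (reroute-invariant (Invariant-↭ old-↭ I) uv (trans (sym (coverage-↭ old-↭ (u , v))) uv≡0)))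
    ; adds      = ↭-trans (halfEdges-↭ (↭-sym new-↭))
                 (↭-trans (↭-sym (halfEdges-≋ new-≋))
                 (↭-trans (reroute-halfEdges _ u _ _ v _ _)
                          (++⁺ˡ (edgeHalves u v) (halfEdges-↭ (↭-sym old-↭)))))
    }
    where
    L = lastOr v bs
    a = headOr as v
    p = lastOr u as
    q = headOr bs u
    S = windowsFrom u as v
    R = windowsFrom v bs u
    old rerouted reoriented : List (Window Vertex)
    old        = (L , u , a) ∷ (p , v , q) ∷ S ++ R
    rerouted   = (L , u , v) ∷ (a , u , v) ∷ (u , v , p) ∷ (u , v , q) ∷ S ++ R
    reoriented = (L , u , v) ∷ (a , u , v) ∷ (u , v , p) ∷ (u , v , q) ∷ map reverseWindow S ++ R
    old-↭ : windows (u ∷ as ++ v ∷ bs) ↭ old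
    old-↭ = subst (_↭ old) (sym (windows-split u as v bs)) (prep _ (shift (p , v , q) S R))
    new-≋ : rerouted ≋ reoriented
    new-≋ = inj₁ refl ∷ inj₁ refl ∷ inj₁ refl ∷ inj₁ refl ∷ Pointwise.++⁺ (≋-reverseWindows S) (Pointwise.refl (inj₁ refl))
    new-↭ : reoriented ↭ windows (u ∷ v ∷ reverse as ++ u ∷ v ∷ bs)
    new-↭ = subst (reoriented ↭_) (sym (windows-reroute u as v bs))
      (prep _ (↭-trans (prep _ (prep _ (prep _ (++⁺ʳ R (↭-sym (↭-reverse (map reverseWindow S)))))))
              (↭-trans (↭.swap _ _ ↭-refl)
                       (prep _ (shifts ((a , u , v) ∷ (u , v , q) ∷ []) (reverse (map reverseWindow S)))))))

  extend-from-head : ∀ {u v} ys → Invariant (windows (u ∷ ys)) → Adj G u v →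
    coverage (windows (u ∷ ys)) (u , v) ≡ 0 → Extension (u ∷ ys) u v
  extend-from-head {v = v} ys I uv uv≡0 with v ∈? ys
  ... | no v∉ys  = detour ys v∉ys I uv uv≡0
  ... | yes v∈ys with as , bs , refl ← ∈-∃++ v∈ys = reroute as bs I uv uv≡0

  extend : ∀ {c u v} → Invariant (windows c) → u ∈ c → Adj G u v → coverage (windows c) (u , v) ≡ 0 →
    Extension c u v
  extend {c} {u} {v} I u∈c uv uv≡0 with xs , ys , refl ← ∈-∃++ u∈c = record
    { Extension rotated
    ; adds = ↭-trans (Extension.adds rotated) (++⁺ˡ (edgeHalves u v) (halfEdges-↭ (↭-sym rotate)))
    }
    where
    rotate : windows (xs ++ u ∷ ys) ↭ windows (u ∷ ys ++ xs)
    rotate = windows-rotate xs (u ∷ ys)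
    rotated : Extension (u ∷ ys ++ xs) u v
    rotated = extend-from-head (ys ++ xs) (Invariant-↭ rotate I) uv (trans (sym (coverage-↭ rotate (u , v))) uv≡0)

  initial-invariant : ∀ {r v} → Adj G r v → Invariant (windows (r ∷ v ∷ []))
  initial-invariant {r} {v} rv =
    Invariant-addsEdge adds Invariant-[] r≢v refl
      ((rv , rv) ∷ (adj-sym rv , adj-sym rv) ∷ []) (λ x → cutsCrossed-single same-end)
    where
    r≢v = adj⇒≢ rv
    adds : AddsEdge r v [] (windows (r ∷ v ∷ []))
    adds = ↭-refl
    same-end : ∀ {x a b} → (x , a) ∈ halfEdges (windows (r ∷ v ∷ [])) →
               (x , b) ∈ halfEdges (windows (r ∷ v ∷ [])) → a ≡ b
    same-end a∈ b∈ with uses-addsEdge adds a∈ | uses-addsEdge adds b∈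
    ... | inj₁ () | _
    ... | _ | inj₁ ()
    ... | inj₂ (inj₁ xa≡rv) | inj₂ (inj₁ xb≡rv) = trans (cong proj₂ xa≡rv) (sym (cong proj₂ xb≡rv))
    ... | inj₂ (inj₂ xa≡vr) | inj₂ (inj₂ xb≡vr) = trans (cong proj₂ xa≡vr) (sym (cong proj₂ xb≡vr))
    ... | inj₂ (inj₁ xa≡rv) | inj₂ (inj₂ xb≡vr) = ⊥-elim (r≢v (trans (sym (cong proj₁ xa≡rv)) (cong proj₁ xb≡vr)))
    ... | inj₂ (inj₂ xa≡vr) | inj₂ (inj₁ xb≡rv) = ⊥-elim (r≢v (trans (sym (cong proj₁ xb≡rv)) (cong proj₁ xa≡vr)))

  record CoveringCycle : Set where
    field
      start     : Vertex
      rest      : List Vertex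
      invariant : Invariant (windows (start ∷ rest))
      covers    : ∀ x y → Adj G x y → coverage (windows (start ∷ rest)) (x , y) ≡ 2

  allHalfEdges : List HalfEdge
  allHalfEdges = cartesianProduct (allFin n) (allFin n)

  ∈-allHalfEdges : ∀ t → t ∈ allHalfEdges
  ∈-allHalfEdges (x , y) = ∈-cartesianProduct⁺ (∈-allFin x) (∈-allFin y)

  Extendable : List Vertex → HalfEdge → Set
  Extendable c (u , v) = Adj G u v × u ∈ c × coverage (windows c) (u , v) ≡ 0

  extendable? : ∀ c t → Dec (Extendable c t)
  extendable? c (u , v) = (Graph.adj G u v ≟ᵇ true) ×-dec (u ∈? c) ×-dec (coverage (windows c) (u , v) ≟ℕ 0)

  -- A walk from the cycle to a cannot leave it: every edge at a vertex of the cycle is already used.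
  covers-if-stuck : Connected G → ∀ {x xs} → Invariant (windows (x ∷ xs)) →
    ¬ Any (Extendable (x ∷ xs)) allHalfEdges → ∀ a b → Adj G a b → coverage (windows (x ∷ xs)) (a , b) ≡ 2
  covers-if-stuck (_ , walk) {x} {xs} I stuck a b ab with coverage (windows (x ∷ xs)) (a , b) ≟ℕ 0
  ... | yes ab≡0 = ⊥-elim (stuck (lose (∈-allHalfEdges (a , b)) (ab , a∈ , ab≡0)))
    where
    open WalkBetween (walk x a)
    reached : ∀ i → i ≤ len → vtx i ∈ x ∷ xs
    reached zero    _       = subst (_∈ x ∷ xs) (sym start) (here refl)
    reached (suc i) i<len with coverage (windows (x ∷ xs)) (vtx i , vtx (suc i)) ≟ℕ 0
    ... | yes step≡0 = ⊥-elim (stuck (lose (∈-allHalfEdges _)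
                         (steps i i<len , reached i (≤-trans (n≤1+n i) i<len) , step≡0)))
    ... | no step≢0  = proj₂ (AsClosedWalk.halfEdges-∈ x xs (multiplicity≢0⇒∈ _ _ step≢0))
    a∈ : a ∈ x ∷ xs
    a∈ = subst (_∈ x ∷ xs) end (reached len ≤-refl)
  ... | no ab≢0 = [ (λ ab≡0 → ⊥-elim (ab≢0 ab≡0)) , (λ ab≡2 → ab≡2) ]′ (coverage-0∨2 I (a , b))

  grow : ∀ k {x xs} → Connected G → Invariant (windows (x ∷ xs)) →
    countZeros (coverage (windows (x ∷ xs))) allHalfEdges < k → CoveringCycle
  grow zero    _ _ ()
  grow (suc k) {x} {xs} connected I bound with Any.any? (extendable? (x ∷ xs)) allHalfEdges
  ... | no stuck = record { start = x ; rest = xs ; invariant = I ; covers = covers-if-stuck connected I stuck }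
  ... | yes can with (u , v) , uv , u∈ , uv≡0 ← satisfied can =
    grow k connected invariant (<-≤-trans fewer-zeros (≤-pred bound))
    where
    open Extension (extend I u∈ uv uv≡0)
    fewer-zeros : countZeros (coverage (windows (start ∷ rest))) allHalfEdges
                < countZeros (coverage (windows (x ∷ xs))) allHalfEdges
    fewer-zeros = countZeros-strict (coverage-monotone adds) uv≡0
      (λ uv≡0′ → 1+n≢0 (trans (sym (coverage-added adds (adj⇒≢ uv) uv≡0)) uv≡0′))
      (∈-allHalfEdges (u , v))

  -- From a covering cycle to a stable trace

  ∈-Nbhd⇒Adj : ∀ {v x} → x ∈ₛ Nbhd G v → Adj G v x
  ∈-Nbhd⇒Adj {v} {x} x∈ = trans (sym (lookup∘tabulate (Graph.adj G v) x)) ([]=⇒lookup x∈)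

  Adj⇒∈-Nbhd : ∀ {v x} → Adj G v x → x ∈ₛ Nbhd G v
  Adj⇒∈-Nbhd {v} {x} vx = lookup⇒[]= x (Nbhd G v) (trans (lookup∘tabulate (Graph.adj G v) x) vx)

  ∣N∣≥1⇒nonempty : ∀ (N : Subset n) → 1 ≤ ∣ N ∣ → Nonempty N
  ∣N∣≥1⇒nonempty N 1≤∣N∣ with nonempty? N
  ... | yes ne = ne
  ... | no ¬ne with () ← ≤-trans 1≤∣N∣ (≤-reflexive (trans (cong ∣_∣ (Empty-unique ¬ne)) (∣⊥∣≡0 n)))

  neighbour-outside : ∀ {d} → MinDegreeGreaterThan G d → ∀ v (N : Subset n) → ∣ N ∣ ≤ d →
    ∃[ b ] (b ∈ₛ Nbhd G v × b ∉ₛ N)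
  neighbour-outside {d} δ>d v N ∣N∣≤d with any? (λ b → (b ∈ₛ? Nbhd G v) ×-dec ¬? (b ∈ₛ? N))
  ... | yes found = found
  ... | no none  = ⊥-elim (<-irrefl refl (<-≤-trans (δ>d v) (≤-trans (p⊆q⇒∣p∣≤∣q∣ Nbhd⊆N) ∣N∣≤d)))
    where
    Nbhd⊆N : Nbhd G v ⊆ N
    Nbhd⊆N {b} b∈ with b ∈ₛ? N
    ... | yes b∈N = b∈N
    ... | no b∉N  = ⊥-elim (none (b , b∈ , b∉N))

  unique-length-2 : ∀ {A : Set} (xs : List A) → Unique xs → length xs ≡ 2 →
    ∃[ i ] ∃[ j ] (i ≢ j × i ∈ xs × j ∈ xs × (∀ k → k ∈ xs → k ≡ i ⊎ k ≡ j))
  unique-length-2 (i ∷ j ∷ []) ((i≢j ∷ []) ∷ _) refl = i , j , i≢j , here refl , there (here refl) , i-or-j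
    where
    i-or-j : ∀ k → k ∈ i ∷ j ∷ [] → k ≡ i ⊎ k ≡ j
    i-or-j k (here k≡i)         = inj₁ k≡i
    i-or-j k (there (here k≡j)) = inj₂ k≡j

  module FromCoveringCycle (C : CoveringCycle) where
    open CoveringCycle C
    open AsClosedWalk start rest

    positions : List (Fin (suc (length rest)))
    positions = allFin (suc (length rest))

    windowAt-∈ : ∀ i → windowAt i ∈ windows cycle
    windowAt-∈ i = subst (windowAt i ∈_) (sym windows-as-map) (∈-map⁺ windowAt (∈-allFin i))

    walk : ClosedWalk G
    walk = record
      { m        = length rest
      ; vtx      = at
      ; adjacent = λ i → proj₂ (All.lookup (windowsAdjacent invariant) (windowAt-∈ i))
      }

    outgoing incoming : Fin (suc (length rest)) → HalfEdge
    outgoing i = (at i , at (next i))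
    incoming i = (at i , at (prev i))

    multiplicity-windowAt : ∀ t is → multiplicity t (halfEdges (map windowAt is))
                                   ≡ multiplicity t (map incoming is) + multiplicity t (map outgoing is)
    multiplicity-windowAt t []       = refl
    multiplicity-windowAt t (i ∷ is) = begin
      ι (incoming i) + (ι (outgoing i) + multiplicity t (halfEdges (map windowAt is)))
        ≡⟨ cong (λ k → ι (incoming i) + (ι (outgoing i) + k)) (multiplicity-windowAt t is) ⟩
      ι (incoming i) + (ι (outgoing i) + (multiplicity t (map incoming is) + multiplicity t (map outgoing is)))
        ≡⟨ cong (ι (incoming i) +_) (x∙yz≈y∙xz (ι (outgoing i)) (multiplicity t (map incoming is)) _) ⟩
      ι (incoming i) + (multiplicity t (map incoming is) + (ι (outgoing i) + multiplicity t (map outgoing is)))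
        ≡⟨ sym (+-assoc (ι (incoming i)) _ _) ⟩
      (ι (incoming i) + multiplicity t (map incoming is)) + (ι (outgoing i) + multiplicity t (map outgoing is)) ∎
      where
      open ≡-Reasoning
      ι : HalfEdge → ℕ
      ι e = indicator (e ≟ʰ t)

    -- Every step enters a vertex exactly once, so incoming half-edges are the reversed outgoing ones.
    multiplicity-incoming : ∀ t →
      multiplicity t (map incoming positions) ≡ multiplicity (swap t) (map outgoing positions)
    multiplicity-incoming t = begin
      multiplicity t (map incoming positions)
        ≡⟨ cong (multiplicity t) (trans (map-cong incoming≗ positions) (map-∘ positions)) ⟩
      multiplicity t (map (swap ∘ outgoing) (map prev positions))
        ≡⟨ multiplicity-↭ t (map⁺ (swap ∘ outgoing) (map-prev-allFin (length rest))) ⟩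
      multiplicity t (map (swap ∘ outgoing) positions)
        ≡⟨ cong (multiplicity t) (map-∘ positions) ⟩
      multiplicity (swap (swap t)) (map swap (map outgoing positions))
        ≡⟨ multiplicity-map-swap (swap t) (map outgoing positions) ⟩
      multiplicity (swap t) (map outgoing positions) ∎
      where
      open ≡-Reasoning
      incoming≗ : ∀ i → incoming i ≡ swap (outgoing (prev i))
      incoming≗ i = cong (λ k → (at k , at (prev i))) (sym (next-prev i))

    traverses? : ∀ x y i → Dec (Traverses G walk i x y)
    traverses? x y i = map′ [ inj₁ ∘ ×-≡,≡←≡ , inj₂ ∘ ×-≡,≡←≡ ]′ [ inj₁ ∘ ×-≡,≡→≡ , inj₂ ∘ ×-≡,≡→≡ ]′
                            ((outgoing i ≟ʰ (x , y)) ⊎-dec (outgoing i ≟ʰ (y , x)))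

    length-traversals : ∀ {x y} → x ≢ y → ∀ is → length (filter (traverses? x y) is)
                      ≡ multiplicity (x , y) (map outgoing is) + multiplicity (y , x) (map outgoing is)
    length-traversals x≢y [] = refl
    length-traversals {x} {y} x≢y (i ∷ is) with outgoing i ≟ʰ (x , y) | outgoing i ≟ʰ (y , x)
    ... | yes xy≡  | yes yx≡ = ⊥-elim (x≢y (trans (sym (cong proj₁ xy≡)) (cong proj₁ yx≡)))
    ... | yes _    | no _    = cong suc (length-traversals x≢y is)
    ... | no _     | yes _   = trans (cong suc (length-traversals x≢y is)) (sym (+-suc _ _))
    ... | no _     | no _    = length-traversals x≢y is

    traversals-2 : ∀ {x y} → Adj G x y → length (filter (traverses? x y) positions) ≡ 2
    traversals-2 {x} {y} xy = begin
      length (filter (traverses? x y) positions)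
        ≡⟨ length-traversals (adj⇒≢ xy) positions ⟩
      multiplicity (x , y) (map outgoing positions) + multiplicity (y , x) (map outgoing positions)
        ≡⟨ +-comm (multiplicity (x , y) (map outgoing positions)) _ ⟩
      multiplicity (y , x) (map outgoing positions) + multiplicity (x , y) (map outgoing positions)
        ≡⟨ cong (_+ multiplicity (x , y) (map outgoing positions)) (sym (multiplicity-incoming (x , y))) ⟩
      multiplicity (x , y) (map incoming positions) + multiplicity (x , y) (map outgoing positions)
        ≡⟨ sym (multiplicity-windowAt (x , y) positions) ⟩
      coverage (map windowAt positions) (x , y)
        ≡⟨ cong (λ ws → coverage ws (x , y)) (sym windows-as-map) ⟩
      coverage (windows cycle) (x , y)
        ≡⟨ covers x y xy ⟩
      2 ∎
      where open ≡-Reasoning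

    doubleTrace : DoubleTrace G
    doubleTrace = record { walk = walk ; twice = twice }
      where
      twice : ∀ x y → Adj G x y → TraversedExactlyTwice G walk x y
      twice x y xy
        with i , j , i≢j , i∈ , j∈ , only ← unique-length-2 (filter (traverses? x y) positions)
                                              (filter⁺ (traverses? x y) (allFin⁺ _)) (traversals-2 xy)
        = i , j , i≢j , proj₂ (∈-filter⁻ (traverses? x y) {xs = positions} i∈)
        , proj₂ (∈-filter⁻ (traverses? x y) {xs = positions} j∈)
        , λ k k-traverses → only k (∈-filter⁺ (traverses? x y) (∈-allFin k) k-traverses)

    halfEdge-used : ∀ {v z} → Adj G v z → (v , z) ∈ halfEdges (windows cycle)
    halfEdge-used {v} {z} vz = multiplicity≢0⇒∈ (v , z) _ (λ vz≡0 → 1+n≢0 (trans (sym (covers v z vz)) vz≡0))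

    crossing-position : ∀ {v σ} → Any (CrossesAt v σ) (windows cycle) →
      ∃[ i ] (at i ≡ v × σ (at (prev i)) ≢ σ (at (next i)))
    crossing-position {v} {σ} crossing = satisfied (map⁻ (subst (Any (CrossesAt v σ)) windows-as-map crossing))

    stable : ∀ {d} → MinDegreeGreaterThan G d → ∀ v (N : Subset n) → 1 ≤ ∣ N ∣ → ∣ N ∣ ≤ d →
      ¬ Repetition G walk v N
    stable δ>d v N 1≤∣N∣ ∣N∣≤d (N⊆Nbhd , repeats) = not-crossed (crossing-position crossed)
      where
      σ : Colouring
      σ y = does (y ∈ₛ? N)
      inside : Nonempty N
      inside = ∣N∣≥1⇒nonempty N 1≤∣N∣
      outside : ∃[ b ] (b ∈ₛ Nbhd G v × b ∉ₛ N)
      outside = neighbour-outside δ>d v N ∣N∣≤d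
      σ-separates : σ (proj₁ inside) ≢ σ (proj₁ outside)
      σ-separates σa≡σb with () ←
        trans (sym (dec-true (_ ∈ₛ? N) (proj₂ inside))) (trans σa≡σb (dec-false (_ ∈ₛ? N) (proj₂ (proj₂ outside))))
      crossed : Any (CrossesAt v σ) (windows cycle)
      crossed = cutsCrossed invariant v σ (halfEdge-used (∈-Nbhd⇒Adj (N⊆Nbhd (proj₂ inside))))
                                          (halfEdge-used (∈-Nbhd⇒Adj (proj₁ (proj₂ outside)))) σ-separates
      not-crossed : ¬ (∃[ i ] (at i ≡ v × σ (at (prev i)) ≢ σ (at (next i))))
      not-crossed (i , at-i≡v , σ-differs) =
        σ-differs (does-⇔ (mk⇔ (proj₂ (repeats i at-i≡v)) (proj₁ (repeats i at-i≡v)))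
                          (at (prev i) ∈ₛ? N) (at (next i) ∈ₛ? N))

    stableTrace : ∀ {d} → MinDegreeGreaterThan G d → StableTrace G d
    stableTrace δ>d = record { trace = doubleTrace ; stable = stable δ>d }

  minDegree⇒stableTrace : Connected G → ∀ d → 1 ≤ d → MinDegreeGreaterThan G d → StableTrace G d
  minDegree⇒stableTrace connected d 1≤d δ>d =
    FromCoveringCycle.stableTrace (grow _ connected (initial-invariant rv) (n<1+n _)) δ>d
    where
    r : Vertex
    r = proj₁ connected
    neighbour : Nonempty (Nbhd G r)
    neighbour = ∣N∣≥1⇒nonempty (Nbhd G r) (≤-trans 1≤d (<⇒≤ (δ>d r)))
    rv : Adj G r (proj₁ neighbour)
    rv = ∈-Nbhd⇒Adj (proj₂ neighbour)

  -- Vertices of small degree are repeated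

  Nbhd-repetition : ∀ W v → Repetition G W v (Nbhd G v)
  Nbhd-repetition W v = (λ x∈ → x∈) , λ i at-i≡v →
      (λ _ → Adj⇒∈-Nbhd (subst (λ x → Adj G x (vtx (prev i))) at-i≡v
               (adj-sym (subst (λ k → Adj G (vtx (prev i)) (vtx k)) (next-prev i) (adjacent (prev i))))))
    , (λ _ → Adj⇒∈-Nbhd (subst (λ x → Adj G x (vtx (next i))) at-i≡v (adjacent i)))
    where open ClosedWalk W

  has-neighbour : Connected G → ClosedWalk G → ∀ v → ∃[ a ] Adj G v a
  has-neighbour (_ , walk) W v with walk v (ClosedWalk.vtx W fzero)
  ... | record { len = zero ; start = start ; end = end } =
    vtx (next fzero) , subst (λ x → Adj G x (vtx (next fzero))) (trans (sym end) start) (adjacent fzero)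
    where open ClosedWalk W
  ... | record { len = suc _ ; vtx = path ; start = start ; steps = steps } =
    path 1 , subst (λ x → Adj G x (path 1)) start (steps 0 (s≤s z≤n))

  1≤degree : ∀ {v a} → Adj G v a → 1 ≤ degree G v
  1≤degree {v} {a} va = subst (_≤ degree G v) (∣⁅x⁆∣≡1 a)
    (p⊆q⇒∣p∣≤∣q∣ (λ x∈⁅a⁆ → subst (_∈ₛ Nbhd G v) (sym (x∈⁅y⁆⇒x≡y a x∈⁅a⁆)) (Adj⇒∈-Nbhd va)))

  stableTrace⇒minDegree : Connected G → ∀ d → StableTrace G d → MinDegreeGreaterThan G d
  stableTrace⇒minDegree connected d T v with d <? degree G v
  ... | yes d<deg = d<deg
  ... | no d≮deg  = ⊥-elim (StableTrace.stable T v (Nbhd G v) (1≤degree (proj₂ (has-neighbour connected W v)))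
                                               (≮⇒≥ d≮deg) (Nbhd-repetition W v))
    where
    W : ClosedWalk G
    W = DoubleTrace.walk (StableTrace.trace T)

proposition3p4 : (G : Graph) → Connected G → (d : ℕ) → 1 ≤ d →
    (StableTrace G d ⇔ MinDegreeGreaterThan G d)
proposition3p4 G connected d 1≤d =
  mk⇔ (stableTrace⇒minDegree G connected d) (minDegree⇒stableTrace G connected d 1≤d)
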